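{- Let $G$ be a finite simple graph, $A\subseteq V(G)$, and $k\ge 2$ an integer. Suppose that (1) there is a vertex $z$ of $G$ that meets every even $A$-cycle of $G$; (2) $G$ does not contain $k$ pairwise edge-disjoint even $A$-cycles; (3) $G$ is $2$-connected; (4) $z\notin A$. Let $B$ be a block of $G-z$ and let $a\in A\cap V(B)$. Then $a$ has at most two neighbours in $B$.
   Context: An even $A$-cycle is a cycle of even length containing at least one vertex of $A$. A block is a maximal connected subgraph without a cutvertex (a maximal $2$-connected subgraph, a bridge, or an isolated vertex). -}

module Defs where

open import Level using (Level; suc; zero)
open import Data.Nat as ℕ using (ℕ; _≤_; NonZero)
open import Data.Nat.DivMod using (_mod_)
open import Data.Nat.Divisibility using (_∣_)
open import Data.Fin using (Fin; toℕ)
open import Data.Fin.Subset using (Subset; _∈_)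
open import Data.Product using (Σ; ∃; ∃-syntax; _×_; _,_)
open import Data.Sum using (_⊎_)
open import Data.Empty using (⊥)
open import Relation.Nullary using (¬_; Dec)
open import Relation.Binary.PropositionalEquality using (_≡_; _≢_)
open import Function.Definitions using (Injective)

record Graph : Set₁ where
  field
    n     : ℕ
    Adj   : Fin n → Fin n → Set
    adj?  : ∀ u v → Dec (Adj u v)
    sym   : ∀ {u v} → Adj u v → Adj v u
    irrefl : ∀ {u} → ¬ Adj u u
open Graph public

data Walk {n : ℕ} (E : Fin n → Fin n → Set) : Fin n → Fin n → Set where
  nil  : ∀ {u} → Walk E u u
  cons : ∀ {u v w} → E u v → Walk E v w → Walk E u w

csuc : ∀ {m} → Fin (ℕ.suc m) → Fin (ℕ.suc m)
csuc {m} i = ℕ.suc (toℕ i) mod ℕ.suc m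

record Cycle (G : Graph) : Set where
  field
    m      : ℕ
    len≥3  : 3 ≤ ℕ.suc m
    vert   : Fin (ℕ.suc m) → Fin (n G)
    inj    : Injective _≡_ _≡_ vert
    adj    : ∀ i → Adj G (vert i) (vert (csuc i))
open Cycle public

length : ∀ {G} → Cycle G → ℕ
length C = ℕ.suc (m C)

OnCycle : ∀ {G} → Cycle G → Fin (n G) → Set
OnCycle C v = ∃[ i ] vert C i ≡ v

CycleEdge : ∀ {G} → Cycle G → Fin (n G) → Fin (n G) → Set
CycleEdge C u v = ∃[ i ] ((vert C i ≡ u × vert C (csuc i) ≡ v)
                        ⊎ (vert C i ≡ v × vert C (csuc i) ≡ u))

EvenACycle : (G : Graph) → Subset (n G) → Cycle G → Set
EvenACycle G A C = (2 ∣ length C) × (∃[ v ] (v ∈ A × OnCycle C v))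

EdgeDisjoint : ∀ {G} → Cycle G → Cycle G → Set
EdgeDisjoint C D = ∀ u v → CycleEdge C u v → CycleEdge D u v → ⊥

HasKDisjointEvenACycles : (G : Graph) → Subset (n G) → ℕ → Set
HasKDisjointEvenACycles G A k =
  Σ (Fin k → Cycle G) λ Cs →
    (∀ i → EvenACycle G A (Cs i)) ×
    (∀ i j → i ≢ j → EdgeDisjoint (Cs i) (Cs j))

TwoConnected : Graph → Set
TwoConnected G =
  (3 ≤ n G) ×
  (∀ v x y → x ≢ v → y ≢ v →
     Walk (λ a b → Adj G a b × a ≢ v × b ≢ v) x y)

record SubgraphMinus (G : Graph) (z : Fin (n G)) : Set₁ where
  field
    V      : Fin (n G) → Set
    E      : Fin (n G) → Fin (n G) → Set
    V-z    : ∀ {v} → V v → v ≢ z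
    E-adj  : ∀ {u v} → E u v → Adj G u v
    E-V    : ∀ {u v} → E u v → V u × V v
    E-sym  : ∀ {u v} → E u v → E v u
open SubgraphMinus public

_⊆G_ : ∀ {G z} → SubgraphMinus G z → SubgraphMinus G z → Set
H ⊆G H' = (∀ v → V H v → V H' v) × (∀ u v → E H u v → E H' u v)

ConnectedSG : ∀ {G z} → SubgraphMinus G z → Set
ConnectedSG H = (∃[ v ] V H v) × (∀ x y → V H x → V H y → Walk (E H) x y)

NoCutvertex : ∀ {G z} → SubgraphMinus G z → Set
NoCutvertex H = ∀ w x y → V H w → V H x → V H y → x ≢ w → y ≢ w →
  Walk (λ a b → E H a b × a ≢ w × b ≢ w) x y

IsBlock : ∀ {G z} → SubgraphMinus G z → Set₁
IsBlock {G} {z} B = ConnectedSG B × NoCutvertex B ×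
  (∀ (H : SubgraphMinus G z) → ConnectedSG H → NoCutvertex H → B ⊆G H → H ⊆G B)

module Submission where

-- Suppose a ∈ A has three distinct neighbours x, y, w
-- in the block B of G - z.  Since B has no cutvertex, B - a is still
-- connected: take a simple path P from x to y in B - a and a path from w to
-- x, and cut the latter at the first vertex c where it meets P.  This gives
-- a theta graph: three internally disjoint paths x-c, c-y, w-c of lengths
-- p, q, r, hence simple paths x~y, x~w, w~y of lengths p+q, p+r, r+q.  Two
-- of p, q, r have the same parity, so one of these three paths between two
-- neighbours of a has even length, and closing it through a gives an even
-- cycle containing a ∈ A.  Its vertices lie in B ∪ {a} ⊆ G - z, contradicting
-- the hypothesis that z meets every even A-cycle.

open import Defs
open import Data.Nat using (ℕ; _≤_)
open import Data.Fin using (Fin)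
open import Data.Fin.Subset using (Subset; _∈_; _∉_)
open import Data.Product using (_×_)
open import Data.Empty using (⊥)
open import Relation.Nullary using (¬_)
open import Relation.Binary.PropositionalEquality using (_≢_)

open import Data.Nat using (zero; suc; _+_; s≤s; z≤n; parity)
open import Data.Nat.DivMod using (_%_; n%n≡0; m<n⇒m%n≡m)
open import Data.Nat.Divisibility using (_∣_; divides; ∣-refl; ∣m∣n⇒∣m+n)
open import Data.Parity.Base as Parity using (Parity; 0ℙ; 1ℙ)
open import Data.Parity.Properties using (p+p≡0ℙ; +-homo-+)
open import Data.Fin as Fin using (fromℕ; inject₁)
open import Data.Fin.Properties using (toℕ-injective; toℕ-fromℕ<; toℕ-fromℕ; toℕ-inject₁; toℕ<n)
open import Data.Product using (Σ; _,_; proj₁; proj₂)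
open import Data.Sum using (_⊎_; inj₁; inj₂; [_,_]) renaming (map to ⊎-map)
open import Data.Empty using (⊥-elim)
open import Function using (_∘_)
open import Relation.Nullary using (yes; no)
open import Relation.Binary.Definitions using (DecidableEquality)
open import Relation.Binary.PropositionalEquality using (_≡_; refl; trans; cong; subst) renaming (sym to ≡-sym)
open import Data.List as List using (List; []; _∷_; _++_; _∷ʳ_; lookup)
open import Data.Nat.Properties using (+-comm)
open import Data.List.Properties using (length-++)
open import Data.List.Relation.Unary.All as All using (All; []; _∷_)
open import Data.List.Relation.Unary.All.Properties using (¬Any⇒All¬; ++⁻ˡ; ++⁻ʳ)
open import Data.List.Relation.Unary.Any using (here; there)
open import Data.List.Relation.Unary.AllPairs using ([]; _∷_) renaming (tail to unique-tail)
open import Data.List.Relation.Unary.Unique.Propositional using (Unique)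
open import Data.List.Relation.Unary.Unique.Propositional.Properties using (++⁺; Unique[x∷xs]⇒x∉xs)
open import Data.List.Relation.Binary.Disjoint.Propositional using (Disjoint)
open import Data.List.Relation.Binary.Subset.Propositional using () renaming (_⊆_ to _⊆ᴸ_)
open import Data.List.Membership.Propositional using () renaming (_∈_ to _∈ᴸ_)
open import Data.List.Membership.Propositional.Properties using (∈-lookup; ∈-++⁺ˡ; ∈-++⁺ʳ; ∈-++⁻)
import Data.List.Membership.DecPropositional as DecMembership

unique-++⁻ : ∀ {V : Set} (xs : List V) {ys} → Unique (xs ++ ys) →
  Unique xs × Unique ys × Disjoint xs ys
unique-++⁻ [] u = [] , u , λ ()
unique-++⁻ (x ∷ xs) (x∉ ∷ u) with unique-++⁻ xs u
... | uxs , uys , disj = (++⁻ˡ xs x∉ ∷ uxs) , uys , disjoint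
  where
  disjoint : Disjoint (x ∷ xs) _
  disjoint (here refl , v∈ys) = All.lookup (++⁻ʳ xs x∉) v∈ys refl
  disjoint (there v∈xs , v∈ys) = disj (v∈xs , v∈ys)

lookup-injective : ∀ {V : Set} {xs : List V} → Unique xs → ∀ i j → lookup xs i ≡ lookup xs j → i ≡ j
lookup-injective (x∉ ∷ u) Fin.zero Fin.zero e = refl
lookup-injective (x∉ ∷ u) Fin.zero (Fin.suc j) e = ⊥-elim (All.lookup x∉ (∈-lookup j) e)
lookup-injective (x∉ ∷ u) (Fin.suc i) Fin.zero e = ⊥-elim (All.lookup x∉ (∈-lookup i) (≡-sym e))
lookup-injective (x∉ ∷ u) (Fin.suc i) (Fin.suc j) e = cong Fin.suc (lookup-injective u i j e)

-- Path R x T y: a walk along R from x to y whose vertices after x are,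
-- in order, the list T (so T has one entry per edge).
data Path {V : Set} (R : V → V → Set) : V → List V → V → Set where
  done : ∀ {x} → Path R x [] x
  step : ∀ {x y T z} → R x y → Path R y T z → Path R x (y ∷ T) z

walk→path : ∀ {k} {R : Fin k → Fin k → Set} {x y} → Walk R x y → Σ (List (Fin k)) λ T → Path R x T y
walk→path nil = [] , done
walk→path (cons r w) = _ , step r (proj₂ (walk→path w))

mapPath : ∀ {V : Set} {R S : V → V → Set} → (∀ {u v} → R u v → S u v) →
  ∀ {x T y} → Path R x T y → Path S x T y
mapPath f done = done
mapPath f (step r p) = step (f r) (mapPath f p)

module _ {V : Set} {R : V → V → Set} where

  end∈ : ∀ {x T y} → Path R x T y → y ∈ᴸ x ∷ T
  end∈ done = here refl
  end∈ (step r p) = there (end∈ p)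

  _++ᴾ_ : ∀ {x T c U y} → Path R x T c → Path R c U y → Path R x (T ++ U) y
  done ++ᴾ q = q
  step r p ++ᴾ q = step r (p ++ᴾ q)

  _∷ʳᴾ_ : ∀ {x T y t} → Path R x T y → R y t → Path R x (T ∷ʳ t) t
  done ∷ʳᴾ r = step r done
  step r′ p ∷ʳᴾ r = step r′ (p ∷ʳᴾ r)

  allTargets : ∀ {P : V → Set} → (∀ {u v} → R u v → P v) → ∀ {x T y} → Path R x T y → All P T
  allTargets f done = []
  allTargets f (step r p) = f r ∷ allTargets f p

  splitAt : ∀ {x T y c} → Path R x T y → c ∈ᴸ x ∷ T →
    Σ (List V) λ T₁ → Σ (List V) λ T₂ → Path R x T₁ c × Path R c T₂ y × T₁ ++ T₂ ≡ T
  splitAt p (here refl) = [] , _ , done , p , refl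
  splitAt done (there ())
  splitAt (step r p) (there c∈) with splitAt p c∈
  ... | T₁ , T₂ , p₁ , p₂ , refl = _ ∷ T₁ , T₂ , step r p₁ , p₂ , refl

record SimplePath {V : Set} (R : V → V → Set) (x y : V) : Set where
  constructor simple
  field
    {inner} : List V
    path    : Path R x inner y
    unique  : Unique (x ∷ inner)

  vertices : List V
  vertices = x ∷ inner

  edges : ℕ
  edges = List.length inner
open SimplePath

module _ {V : Set} {R : V → V → Set} where

  suffix : ∀ {x y z} (P : SimplePath R y z) → x ∈ᴸ vertices P →
    Σ (SimplePath R x z) λ Q → vertices Q ⊆ᴸ vertices P
  suffix P (here refl) = P , λ v∈ → v∈
  suffix (simple done _) (there ())
  suffix (simple (step r p) (_ ∷ u)) (there x∈) with suffix (simple p u) x∈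
  ... | Q , Q⊆ = Q , there ∘ Q⊆

  reverse : (∀ {u v} → R u v → R v u) → ∀ {x y} (P : SimplePath R x y) →
    Σ (SimplePath R y x) λ Q → edges Q ≡ edges P × vertices Q ⊆ᴸ vertices P
  reverse sym-R (simple done u) = simple done u , refl , λ v∈ → v∈
  reverse sym-R {x} (simple (step {T = T} r p) (x∉ ∷ u)) with reverse sym-R (simple p u)
  ... | simple {Q} q uq , len , Q⊆ =
    simple (q ∷ʳᴾ sym-R r) (++⁺ uq ([] ∷ []) x∉Q) , edges-eq , ⊆P
    where
    x∉Q : Disjoint (_ ∷ Q) (x ∷ [])
    x∉Q (v∈ , here refl) = All.lookup x∉ (Q⊆ v∈) refl
    edges-eq : List.length (Q ∷ʳ x) ≡ suc (List.length T)
    edges-eq = trans (length-++ Q) (trans (+-comm (List.length Q) 1) (cong suc len))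
    ⊆P : _ ∷ Q ∷ʳ x ⊆ᴸ x ∷ _ ∷ T
    ⊆P v∈ with ∈-++⁻ (_ ∷ Q) v∈
    ... | inj₁ v∈Q = there (Q⊆ v∈Q)
    ... | inj₂ (here refl) = here refl

  record Attachment (S : List V) (w : V) : Set where
    constructor attachment
    field
      {end}      : V
      end∈S      : end ∈ᴸ S
      route      : SimplePath R w end
      meetsAtEnd : ∀ {v} → v ∈ᴸ vertices route → v ∈ᴸ S → v ≡ end

  module _ (_≟_ : DecidableEquality V) where
    open DecMembership _≟_ using (_∈?_)

    shortcut : ∀ {x T y} → Path R x T y → Σ (SimplePath R x y) λ P → vertices P ⊆ᴸ x ∷ T
    shortcut done = simple done ([] ∷ []) , λ v∈ → v∈
    shortcut {x} (step r p) with shortcut p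
    ... | P , P⊆ with x ∈? vertices P
    ...   | yes x∈P = proj₁ (suffix P x∈P) , there ∘ P⊆ ∘ proj₂ (suffix P x∈P)
    ...   | no  x∉P = simple (step r (path P)) (¬Any⇒All¬ _ x∉P ∷ unique P) , ⊆step
      where
      ⊆step : x ∷ vertices P ⊆ᴸ x ∷ _
      ⊆step (here refl) = here refl
      ⊆step (there v∈) = there (P⊆ v∈)

    firstHit : ∀ (S : List V) {w T v} → Path R w T v → v ∈ᴸ S →
      Σ V λ c → Σ (List V) λ T′ → c ∈ᴸ S × Path R w T′ c × (∀ {u} → u ∈ᴸ w ∷ T′ → u ∈ᴸ S → u ≡ c)
    firstHit S {w} p v∈S with w ∈? S
    ... | yes w∈S = w , [] , w∈S , done , λ { (here refl) _ → refl }
    firstHit S done v∈S | no w∉S = ⊥-elim (w∉S v∈S)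
    firstHit S (step r p) v∈S | no w∉S with firstHit S p v∈S
    ... | c , T′ , c∈S , p′ , first = c , _ , c∈S , step r p′ , first′
      where
      first′ : ∀ {u} → u ∈ᴸ _ ∷ _ ∷ T′ → u ∈ᴸ S → u ≡ c
      first′ (here refl) u∈S = ⊥-elim (w∉S u∈S)
      first′ (there u∈) u∈S = first u∈ u∈S

    attach : ∀ {S w T v} → Path R w T v → v ∈ᴸ S → Attachment S w
    attach {S} p v∈S with firstHit S p v∈S
    ... | c , T′ , c∈S , p′ , first with shortcut p′
    ...   | Q , Q⊆ = record { end∈S = c∈S ; route = Q ; meetsAtEnd = first ∘ Q⊆ }

  -- A theta graph on x, y, w: simple paths joining each pair, of lengths
  -- p + q, p + r and r + q, as produced by three internally disjoint
  -- branches of lengths p, q, r from x, y, w to a common vertex.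
  record Theta (x y w : V) : Set where
    field
      p q r    : ℕ
      xy       : SimplePath R x y
      xy-edges : edges xy ≡ p + q
      xw       : SimplePath R x w
      xw-edges : edges xw ≡ p + r
      wy       : SimplePath R w y
      wy-edges : edges wy ≡ r + q

  theta : (∀ {u v} → R u v → R v u) → ∀ {x y w} (P : SimplePath R x y) →
    Attachment (vertices P) w → Theta x y w
  theta sym-R {x} (simple pP uP) (attachment end∈S route meetsAtEnd) with splitAt pP end∈S
  ... | T₁ , T₂ , p₁ , p₂ , refl with unique-++⁻ (x ∷ T₁) uP | reverse sym-R route
  ... | u₁ , u₂ , disj₁₂ | route⁻¹ , len⁻¹ , ⊆route = record
    { p = List.length T₁ ; q = List.length T₂ ; r = edges route
    ; xy = simple pP uP ; xy-edges = length-++ T₁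
    ; xw = simple (p₁ ++ᴾ path route⁻¹) (++⁺ u₁ (unique-tail (unique route⁻¹)) disjˣʷ)
    ; xw-edges = trans (length-++ T₁) (cong (List.length T₁ +_) len⁻¹)
    ; wy = simple (path route ++ᴾ p₂) (++⁺ (unique route) u₂ disjʷʸ)
    ; wy-edges = length-++ (inner route)
    }
    where
    disjˣʷ : Disjoint (x ∷ T₁) (inner route⁻¹)
    disjˣʷ {v} (v∈₁ , v∈⁻¹) = Unique[x∷xs]⇒x∉xs (unique route⁻¹) (subst (_∈ᴸ inner route⁻¹) v≡end v∈⁻¹)
      where
      v≡end : v ≡ _
      v≡end = meetsAtEnd (⊆route (there v∈⁻¹)) (∈-++⁺ˡ v∈₁)
    disjʷʸ : Disjoint (vertices route) T₂
    disjʷʸ {v} (v∈route , v∈₂) = disj₁₂ (end∈ p₁ , subst (_∈ᴸ T₂) (meetsAtEnd v∈route (∈-++⁺ʳ (x ∷ T₁) v∈₂)) v∈₂)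

evenSum : ∀ m n → parity m ≡ parity n → 2 ∣ m + n
evenSum m n same = parity0⇒even (m + n) (trans (+-homo-+ m n)
  (trans (cong (Parity._+ parity n) same) (p+p≡0ℙ (parity n))))
  where
  parity0⇒even : ∀ k → parity k ≡ 0ℙ → 2 ∣ k
  parity0⇒even zero _ = divides 0 refl
  parity0⇒even (suc zero) ()
  parity0⇒even (suc (suc k)) e = ∣m∣n⇒∣m+n {2} {2} ∣-refl (parity0⇒even k e)

pigeonhole : (a b c : Parity) → a ≡ b ⊎ a ≡ c ⊎ c ≡ b
pigeonhole 0ℙ 0ℙ _  = inj₁ refl
pigeonhole 1ℙ 1ℙ _  = inj₁ refl
pigeonhole 0ℙ 1ℙ 0ℙ = inj₂ (inj₁ refl)
pigeonhole 1ℙ 0ℙ 1ℙ = inj₂ (inj₁ refl)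
pigeonhole 0ℙ 1ℙ 1ℙ = inj₂ (inj₂ refl)
pigeonhole 1ℙ 0ℙ 0ℙ = inj₂ (inj₂ refl)

EvenPath : ∀ {V : Set} (R : V → V → Set) (s t : V) → Set
EvenPath R s t = Σ (SimplePath R s t) λ P → 2 ∣ edges P

someEvenSide : ∀ {V : Set} {R : V → V → Set} {x y w} → Theta {R = R} x y w →
  EvenPath R x y ⊎ EvenPath R x w ⊎ EvenPath R w y
someEvenSide {R = R} θ =
  ⊎-map (even xy p q xy-edges) (⊎-map (even xw p r xw-edges) (even wy r q wy-edges))
    (pigeonhole (parity p) (parity q) (parity r))
  where
  open Theta θ
  even : ∀ {s t} (P : SimplePath R s t) m n → edges P ≡ m + n → parity m ≡ parity n → EvenPath R s t
  even P m n e same = P , subst (2 ∣_) (≡-sym e) (evenSum m n same)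

data LastOrInject : ∀ {m} → Fin (suc m) → Set where
  last   : ∀ {m} → LastOrInject (fromℕ m)
  inject : ∀ {m} (j : Fin m) → LastOrInject (inject₁ j)

lastOrInject : ∀ {m} (i : Fin (suc m)) → LastOrInject i
lastOrInject {zero} Fin.zero = last
lastOrInject {suc m} Fin.zero = inject Fin.zero
lastOrInject {suc m} (Fin.suc i) with lastOrInject i
... | last = last
... | inject j = inject (Fin.suc j)

csuc-last : ∀ m → csuc (fromℕ m) ≡ Fin.zero
csuc-last m = toℕ-injective (trans (toℕ-fromℕ< _)
  (trans (cong (λ t → suc t % suc m) (toℕ-fromℕ m)) (n%n≡0 (suc m))))

csuc-inject : ∀ {m} (j : Fin m) → csuc (inject₁ j) ≡ Fin.suc j
csuc-inject {m} j = toℕ-injective (trans (toℕ-fromℕ< _)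
  (trans (cong (λ t → suc t % suc m) (toℕ-inject₁ j)) (m<n⇒m%n≡m (s≤s (toℕ<n j)))))

module _ {V : Set} {R : V → V → Set} where
  path-consecutive : ∀ {x T y} → Path R x T y → (j : Fin (List.length T)) →
    R (lookup (x ∷ T) (inject₁ j)) (lookup T j)
  path-consecutive (step r p) Fin.zero = r
  path-consecutive (step r p) (Fin.suc j) = path-consecutive p j

  nonempty : ∀ {x T y} → Path R x T y → x ≢ y → 1 ≤ List.length T
  nonempty done x≢y = ⊥-elim (x≢y refl)
  nonempty (step _ _) _ = s≤s z≤n

  path-last : ∀ {x T y} → Path R x T y → lookup (x ∷ T) (fromℕ (List.length T)) ≡ y
  path-last done = refl
  path-last (step r p) = path-last p

closeCycle : (G : Graph) → ∀ {a u v T} → Path (Adj G) u T v → Unique (a ∷ u ∷ T) →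
  Adj G a u → Adj G v a → u ≢ v →
  Σ (Cycle G) λ C → length C ≡ 2 + List.length T × OnCycle C a × (∀ {t} → OnCycle C t → t ∈ᴸ a ∷ u ∷ T)
closeCycle G {a} {u} {v} {T} p uniq au va u≢v = C , refl , (Fin.zero , refl) , λ { (i , refl) → ∈-lookup i }
  where
  K : List (Fin (n G))
  K = a ∷ u ∷ T
  pa : Path (Adj G) a (u ∷ T) v
  pa = step au p
  adjacent : ∀ i → Adj G (lookup K i) (lookup K (csuc i))
  adjacent i with lastOrInject i
  ... | last = subst (λ j → Adj G (lookup K (fromℕ (List.length (u ∷ T)))) (lookup K j))
                 (≡-sym (csuc-last (List.length (u ∷ T))))
                 (subst (λ t → Adj G t a) (≡-sym (path-last pa)) va)
  ... | inject j = subst (λ j′ → Adj G (lookup K (inject₁ j)) (lookup K j′))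
                 (≡-sym (csuc-inject j)) (path-consecutive pa j)
  C : Cycle G
  C = record { m = suc (List.length T) ; len≥3 = s≤s (s≤s (nonempty p u≢v))
             ; vert = lookup K ; inj = λ {i} {j} → lookup-injective uniq i j ; adj = adjacent }

module EvenCycleThrough (G : Graph) (A : Subset (n G)) (z : Fin (n G))
  (hitsAll : ∀ (C : Cycle G) → EvenACycle G A C → OnCycle C z)
  (B : SubgraphMinus G z) (a : Fin (n G)) (a∈A : a ∈ A) (a∈B : V B a) where

  R : Fin (n G) → Fin (n G) → Set
  R u v = E B u v × u ≢ a × v ≢ a

  R-sym : ∀ {u v} → R u v → R v u
  R-sym (e , u≢a , v≢a) = E-sym B e , v≢a , u≢a

  neighbour≢a : ∀ {t} → E B a t → t ≢ a
  neighbour≢a e refl = irrefl G (E-adj B e)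

  -- The closed cycle a s … t has even length and contains a ∈ A but not z.
  noEvenPath : ∀ {s t} → E B a s → E B a t → s ≢ t → EvenPath R s t → ⊥
  noEvenPath as at s≢t (simple {T} p uniq , even)
    with closeCycle G (mapPath (E-adj B ∘ proj₁) p) (a∉ ∷ uniq) (E-adj B as) (E-adj B (E-sym B at)) s≢t
    where
    a∉ : All (a ≢_) (_ ∷ T)
    a∉ = (neighbour≢a as ∘ ≡-sym) ∷ allTargets (λ r → proj₂ (proj₂ r) ∘ ≡-sym) p
  ... | C , refl , a∈C , C⊆ = z∉ (C⊆ (hitsAll C (∣m∣n⇒∣m+n {2} {2} ∣-refl even , a , a∈A , a∈C)))
    where
    z∉ : ¬ (z ∈ᴸ a ∷ _ ∷ T)
    z∉ (here refl) = V-z B a∈B refl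
    z∉ (there (here refl)) = V-z B (proj₂ (E-V B as)) refl
    z∉ (there (there z∈T)) = All.lookup (allTargets (λ r → V-z B (proj₂ (E-V B (proj₁ r)))) p) z∈T refl

lemma13 : (G : Graph) (A : Subset (n G)) (k : ℕ) → 2 ≤ k →
    (z : Fin (n G)) →
    (∀ (C : Cycle G) → EvenACycle G A C → OnCycle C z) →
    ¬ HasKDisjointEvenACycles G A k →
    TwoConnected G →
    z ∉ A →
    (B : SubgraphMinus G z) → IsBlock B →
    (a : Fin (n G)) → a ∈ A → V B a →
    (x y w : Fin (n G)) → E B a x → E B a y → E B a w →
    x ≢ y → x ≢ w → y ≢ w → ⊥
-- Only hypothesis (1) and the absence of a cutvertex in B are needed.
lemma13 G A k _ z hitsAll _ _ _ B (_ , noCut , _) a a∈A a∈B x y w ax ay aw x≢y x≢w y≢w =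
  [ noEvenPath ax ay x≢y , [ noEvenPath ax aw x≢w , noEvenPath aw ay (y≢w ∘ ≡-sym) ] ]
    (someEvenSide (theta R-sym P (attach Fin._≟_ (proj₂ (walk→path w~x)) (here refl))))
  where
  open EvenCycleThrough G A z hitsAll B a a∈A a∈B
  x∈B : V B x
  x∈B = proj₂ (E-V B ax)
  -- B has no cutvertex, so B - a still connects x, y and w.
  x~y : Walk R x y
  x~y = noCut a x y a∈B x∈B (proj₂ (E-V B ay)) (neighbour≢a ax) (neighbour≢a ay)
  w~x : Walk R w x
  w~x = noCut a w x a∈B (proj₂ (E-V B aw)) x∈B (neighbour≢a aw) (neighbour≢a ax)
  P : SimplePath R x y
  P = proj₁ (shortcut Fin._≟_ (proj₂ (walk→path x~y)))
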